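{- For every pair $a,b$ of nonzero rational numbers, the set of rational points on the surface $\mathcal{S}: x^2+ay^5-z^6=b$ is infinite. -}

module Defs where

open import Data.Rational using (ℚ; _+_; _*_; _-_)
open import Data.Rational using (1ℚ)
open import Data.Nat using (ℕ; zero; suc)
open import Data.Product using (_×_; _,_; Σ; ∃)
open import Data.List using (List)
open import Data.List.Membership.Propositional using (_∉_)
open import Relation.Binary.PropositionalEquality using (_≡_)

_^_ : ℚ → ℕ → ℚ
q ^ zero = 1ℚ
q ^ suc n = q * (q ^ n)

Point : Set
Point = ℚ × ℚ × ℚ

OnSurface : ℚ → ℚ → Point → Set
OnSurface a b (x , y , z) = (x ^ 2) + a * (y ^ 5) - (z ^ 6) ≡ b

InfinitelyMany : (Point → Set) → Set
InfinitelyMany P = (l : List Point) → Σ Point (λ p → P p × p ∉ l)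

-- The polynomial identity (z³ + a³v⁵)² + a(−av²)⁵ − z⁶ = 2a³v⁵z³ reduces the problem to
-- 2a³v⁵z³ = b, which is solved for every t ≠ 0 by v = 2t³/b, z = b²/(4at⁵). On this
-- family yz = −t, so distinct parameters give distinct points.
module Submission where

open import Defs
open import Data.Rational using (ℚ; ↥_; 0ℚ; 1ℚ; _+_; _*_; -_; 1/_; NonZero; ≢-nonZero)
open import Data.Rational.Literals using (fromℤ)
open import Data.Rational.Properties using (_≟_; *-inverseʳ; *-identityˡ; *-identityʳ; neg-injective)
open import Data.Rational.Solver using (module +-*-Solver)
open import Data.Integer using (+_)
open import Data.Nat as ℕ using (ℕ; zero; suc)
open import Data.Nat.Properties using (+-cancelˡ-≡; m≢1+m+n)
open import Data.Product using (_,_; ∃)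
open import Data.Product.Properties using (≡-dec)
open import Data.List using (List; []; _∷_)
open import Data.List.Relation.Unary.Any using (here; there)
open import Data.List.Membership.Propositional using (_∉_)
open import Function.Definitions using (Injective)
open import Relation.Nullary using (yes; no)
open import Relation.Binary.Definitions using (DecidableEquality)
open import Relation.Binary.PropositionalEquality

∉-∷⁺ : ∀ {A : Set} {x y : A} {ys : List A} → x ≢ y → x ∉ ys → x ∉ y ∷ ys
∉-∷⁺ x≢y _    (here x≡y)   = x≢y x≡y
∉-∷⁺ _   x∉ys (there x∈ys) = x∉ys x∈ys

injective⇒∃∉ : ∀ {A : Set} → DecidableEquality A → (f : ℕ → A) →
               Injective _≡_ _≡_ f → (l : List A) → ∃ λ n → f n ∉ l
injective⇒∃∉ _ f _ [] = 0 , λ ()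
injective⇒∃∉ _≟A_ f f-inj (x ∷ xs) with injective⇒∃∉ _≟A_ f f-inj xs
... | n , fn∉xs with f n ≟A x
...   | no fn≢x = n , ∉-∷⁺ fn≢x fn∉xs
...   | yes fn≡x =
  -- by injectivity no later value f (1 + n + k) is x
  let k , fk∉xs = injective⇒∃∉ _≟A_ (λ k → f (suc n ℕ.+ k))
                                (λ eq → +-cancelˡ-≡ (suc n) _ _ (f-inj eq)) xs
  in suc n ℕ.+ k , ∉-∷⁺ (λ eq → m≢1+m+n n (f-inj (trans fn≡x (sym eq)))) fk∉xs

infinitelyMany : ∀ {P : Point → Set} (f : ℕ → Point) → Injective _≡_ _≡_ f →
                 (∀ n → P (f n)) → InfinitelyMany P
infinitelyMany f f-inj Pf l =
  let n , fn∉l = injective⇒∃∉ (≡-dec _≟_ (≡-dec _≟_ _≟_)) f f-inj l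
  in f n , Pf n , fn∉l

open +-*-Solver

two quarter : ℚ
two     = fromℤ (+ 2)
quarter = 1/ fromℤ (+ 4)

surfacePoint : ℚ → ℚ → ℚ → Point
surfacePoint a v z = z ^ 3 + a ^ 3 * v ^ 5 , - (a * v ^ 2) , z

surfacePoint-onSurface : ∀ a v z → OnSurface a (two * a ^ 3 * v ^ 5 * z ^ 3) (surfacePoint a v z)
surfacePoint-onSurface = solve 3 (λ a v z →
  (z :^ 3 :+ a :^ 3 :* v :^ 5) :^ 2 :+ a :* (:- (a :* v :^ 2)) :^ 5 :- z :^ 6
  := con two :* a :^ 3 :* v :^ 5 :* z :^ 3) refl

1ℚ^n≡1ℚ : ∀ n → 1ℚ ^ n ≡ 1ℚ
1ℚ^n≡1ℚ zero    = refl
1ℚ^n≡1ℚ (suc n) = trans (*-identityˡ (1ℚ ^ n)) (1ℚ^n≡1ℚ n)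

*-powers-of-1 : ∀ {p q r} → p ≡ 1ℚ → q ≡ 1ℚ → r ≡ 1ℚ →
          ∀ c i j k → c * (p ^ i * q ^ j * r ^ k) ≡ c
*-powers-of-1 refl refl refl c i j k = begin
  c * (1ℚ ^ i * 1ℚ ^ j * 1ℚ ^ k)  ≡⟨ cong (c *_) (cong₂ _*_ (cong₂ _*_ (1ℚ^n≡1ℚ i) (1ℚ^n≡1ℚ j)) (1ℚ^n≡1ℚ k)) ⟩
  c * 1ℚ                          ≡⟨ *-identityʳ c ⟩
  c                               ∎
  where open ≡-Reasoning

sucℚ : ℕ → ℚ
sucℚ n = fromℤ (+ suc n)

sucℚ-injective : Injective _≡_ _≡_ sucℚ
sucℚ-injective eq with cong ↥_ eq
... | refl = refl

module _ (a b : ℚ) .{{_ : NonZero a}} .{{_ : NonZero b}} where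

  v z : (t : ℚ) .{{_ : NonZero t}} → ℚ
  v t = two * 1/ b * t ^ 3
  z t = quarter * 1/ a * b ^ 2 * (1/ t) ^ 5

  solution : (t : ℚ) .{{_ : NonZero t}} → Point
  solution t = surfacePoint a (v t) (z t)

  solution-onSurface : ∀ t .{{_ : NonZero t}} → OnSurface a b (solution t)
  solution-onSurface t =
    subst (λ c → OnSurface a c (solution t)) weight≡b (surfacePoint-onSurface a (v t) (z t))
    where
    weight≡b : two * a ^ 3 * v t ^ 5 * z t ^ 3 ≡ b
    weight≡b = trans (balance a (1/ a) b (1/ b) t (1/ t))
                     (*-powers-of-1 (*-inverseʳ a) (*-inverseʳ b) (*-inverseʳ t) b 3 5 15)
      where
      -- ia, ib, it stand for the inverses, turning the field identity into a ring identity.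
      balance : ∀ a ia b ib t it →
                two * a ^ 3 * (two * ib * t ^ 3) ^ 5 * (quarter * ia * b ^ 2 * it ^ 5) ^ 3
                ≡ b * ((a * ia) ^ 3 * (b * ib) ^ 5 * (t * it) ^ 15)
      balance = solve 6 (λ a ia b ib t it →
        con two :* a :^ 3 :* (con two :* ib :* t :^ 3) :^ 5 :* (con quarter :* ia :* b :^ 2 :* it :^ 5) :^ 3
        := b :* ((a :* ia) :^ 3 :* (b :* ib) :^ 5 :* (t :* it) :^ 15)) refl

  solution-yz : ∀ t .{{_ : NonZero t}} → - (a * v t ^ 2) * z t ≡ - t
  solution-yz t = trans (balance a (1/ a) b (1/ b) t (1/ t))
                        (cong -_ (*-powers-of-1 (*-inverseʳ a) (*-inverseʳ b) (*-inverseʳ t) t 1 2 5))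
    where
    balance : ∀ a ia b ib t it →
              - (a * (two * ib * t ^ 3) ^ 2) * (quarter * ia * b ^ 2 * it ^ 5)
              ≡ - (t * ((a * ia) ^ 1 * (b * ib) ^ 2 * (t * it) ^ 5))
    balance = solve 6 (λ a ia b ib t it →
      :- (a :* (con two :* ib :* t :^ 3) :^ 2) :* (con quarter :* ia :* b :^ 2 :* it :^ 5)
      := :- (t :* ((a :* ia) :^ 1 :* (b :* ib) :^ 2 :* (t :* it) :^ 5))) refl

  solution∘sucℚ-injective : Injective _≡_ _≡_ (λ n → solution (sucℚ n))
  solution∘sucℚ-injective {m} {n} eq = sucℚ-injective (neg-injective (begin
    - sucℚ m                   ≡⟨ solution-yz (sucℚ m) ⟨
    yz (solution (sucℚ m))     ≡⟨ cong yz eq ⟩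
    yz (solution (sucℚ n))     ≡⟨ solution-yz (sucℚ n) ⟩
    - sucℚ n                   ∎))
    where
    open ≡-Reasoning
    yz : Point → ℚ
    yz (_ , y , z) = y * z

theorem2 : (a b : ℚ) → a ≢ 0ℚ → b ≢ 0ℚ → InfinitelyMany (OnSurface a b)
theorem2 a b a≢0 b≢0 =
  infinitelyMany (λ n → solution a b (sucℚ n)) (solution∘sucℚ-injective a b)
                 (λ n → solution-onSurface a b (sucℚ n))
  where instance
  a≢0ℚ = ≢-nonZero a≢0
  b≢0ℚ = ≢-nonZero b≢0
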